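{- If $G$ is a connected $K_4$-core with $e_G/v_G \le m_2(K_4) = 5/2$, then $G = K_6$.
   Context: The $K_4$-hypergraph of $G$ has vertex set $E(G)$ and a hyperedge for the edge set of each copy of $K_4$ in $G$. A connected hypergraph $H$ is a core if for every edge $e$ and vertex $v\in e$ there is an edge $e'$ with $e\cap e'=\{v\}$. $G$ is a $K_4$-core if its $K_4$-hypergraph contains a spanning connected subhypergraph that is a core. -}

module Defs where

open import Data.Nat using (ℕ; _+_; _<ᵇ_; _≤_; _*_)
open import Data.Bool using (Bool; true; false; if_then_else_; _∧_)
open import Data.Fin using (Fin; toℕ)
open import Data.Fin.Subset using (Subset; _∈_; ∣_∣)
open import Data.List using (map; allFin)
open import Data.Nat.ListAction using (sum)
open import Data.Product using (Σ; ∃; _×_; _,_)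
open import Data.Sum using (_⊎_)
open import Relation.Binary.PropositionalEquality using (_≡_; _≢_)
open import Relation.Binary.Construct.Closure.ReflexiveTransitive using (Star)
open import Function.Bundles using (_⇔_; _↔_; Inverse)
open import Level using (0ℓ)

record Graph (n : ℕ) : Set where
  field
    adj     : Fin n → Fin n → Bool
    symm    : ∀ i j → adj i j ≡ adj j i
    irrefl  : ∀ i → adj i i ≡ false
open Graph public

Adj : ∀ {n} → Graph n → Fin n → Fin n → Set
Adj G i j = adj G i j ≡ true

edgeCount : ∀ {n} → Graph n → ℕ
edgeCount {n} G =
  sum (map (λ i → sum (map (λ j →
    if (toℕ i <ᵇ toℕ j) ∧ adj G i j then 1 else 0) (allFin n))) (allFin n))

Connected : ∀ {n} → Graph n → Set
Connected {n} G = Fin n × (∀ i j → Star (Adj G) i j)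

complete : (m : ℕ) → Graph m
complete m = record { adj = λ i j → not≡ i j ; symm = sy ; irrefl = ir }
  where
  open import Data.Fin using (_≟_)
  open import Relation.Nullary using (yes; no)
  open import Relation.Binary.PropositionalEquality using (refl; sym)
  not≡ : Fin m → Fin m → Bool
  not≡ i j with i ≟ j
  ... | yes _ = false
  ... | no _ = true
  sy : ∀ i j → not≡ i j ≡ not≡ j i
  sy i j with i ≟ j | j ≟ i
  ... | yes _ | yes _ = refl
  ... | no _  | no _  = refl
  ... | yes p | no q  = Data.Empty.⊥-elim (q (sym p))
    where import Data.Empty
  ... | no p  | yes q = Data.Empty.⊥-elim (p (sym q))
    where import Data.Empty
  ir : ∀ i → not≡ i i ≡ false
  ir i with i ≟ i
  ... | yes _ = refl
  ... | no p = Data.Empty.⊥-elim (p refl)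
    where import Data.Empty

Isomorphic : ∀ {n m} → Graph n → Graph m → Set
Isomorphic {n} {m} G H =
  Σ (Fin n ↔ Fin m) λ f → ∀ i j → adj G i j ≡ adj H (Inverse.to f i) (Inverse.to f j)

IsK4 : ∀ {n} → Graph n → Subset n → Set
IsK4 G Q = (∣ Q ∣ ≡ 4) × (∀ x y → x ∈ Q → y ∈ Q → x ≢ y → Adj G x y)

EdgeIn : ∀ {n} → Subset n → Fin n → Fin n → Set
EdgeIn Q x y = (x ≢ y) × (x ∈ Q) × (y ∈ Q)

-- Two vertices {x,y},{u,v} of the K4-hypergraph lie in a common hyperedge of S.
Linked : ∀ {n} → (Subset n → Set) → Fin n × Fin n → Fin n × Fin n → Set
Linked S (x , y) (u , v) = ∃ λ Q → S Q × EdgeIn Q x y × EdgeIn Q u v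

-- S (a set of hyperedges of the K4-hypergraph of G) forms a spanning,
-- connected subhypergraph that is a core.
SpanningConnectedCore : ∀ {n} → Graph n → (Subset n → Set) → Set
SpanningConnectedCore {n} G S =
    (∀ Q → S Q → IsK4 G Q)
    -- connected: nonempty vertex set (E(G) ≠ ∅) ...
  × (∃ λ x → ∃ λ y → Adj G x y)
    -- ... every vertex (edge of G) lies in a hyperedge of S ...
  × (∀ x y → Adj G x y → ∃ λ Q → S Q × EdgeIn Q x y)
    -- ... and any two vertices are joined by a chain of hyperedges of S
  × (∀ x y u v → Adj G x y → Adj G u v → Star (Linked S) (x , y) (u , v))
    -- core: for each hyperedge Q and vertex {x,y} ∈ Q there is Q' in S
    -- whose edge set meets that of Q exactly in {{x,y}}
  × (∀ Q → S Q → ∀ x y → EdgeIn Q x y →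
       ∃ λ Q' → S Q' ×
         (∀ u v → (EdgeIn Q u v × EdgeIn Q' u v)
                  ⇔ ((u ≡ x × v ≡ y) ⊎ (u ≡ y × v ≡ x))))

K4Core : ∀ {n} → Graph n → Set₁
K4Core {n} G = Σ (Subset n → Set) λ S → SpanningConnectedCore G S

-- Every vertex v of a K₄-core has degree at least 5: an edge va lies in a copy Q of K₄, and the
-- core property gives a second copy of K₄ through va meeting Q only in that edge, so v has the
-- neighbours a, b, c in Q and two more, d and e, outside Q. By the handshake lemma, e_G ≤ 5v_G/2
-- then forces every degree to be exactly 5, so d and e are all of v's neighbours outside Q.
-- Applying the core property to the edges vb and vc shows that b and c are also adjacent to d and
-- e; hence {v, a, b, c, d, e} is a K₆ that fills the closed neighbourhood of each of its vertices,
-- and as G is connected, G is this K₆.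
module Submission where

open import Defs
open import Data.Nat using (ℕ; zero; suc; _+_; _*_; _≤_; _<_; _<ᵇ_; z≤n; s≤s)
open import Data.Nat.Properties
  using ( +-0-commutativeMonoid; +-identityʳ; +-suc; +-comm; *-comm; +-mono-≤; +-monoʳ-≤
        ; +-cancelʳ-≤; ≤-trans; ≤-reflexive; ≤-pred; ≤-antisym; n≤1+n; n≮n; >⇒≢; <-asym; ≮⇒≥
        ; <ᵇ⇒<; <⇒<ᵇ; module ≤-Reasoning)
open import Data.Bool using (Bool; true; false; if_then_else_; _∧_; T)
open import Data.Fin using (Fin; zero; suc; toℕ; _≟_; punchIn)
open import Data.Fin.Properties using (toℕ-injective)
open import Data.Fin.Subset using (Subset; _∈_; _∉_; ∣_∣; _∪_; _-_; ⁅_⁆; inside; outside; Nonempty)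
open import Data.Fin.Subset.Properties
  using ( p─⊥≡p; p─q⊆p; x∈p⇒∣p-x∣<∣p∣; x∈p∧x≢y⇒x∈p-y; nonempty?; Empty-unique; ∣⊥∣≡0
        ; x∈p∪q⁺; x∈⁅x⁆; ∣⁅x⁆∣≡1)
open import Data.Vec using ([]; _∷_)
import Data.Vec as Vec
open import Data.Vec.Properties using (lookup⇒[]=; lookup∘tabulate)
open import Data.Vec.Functional using (removeAt)
open import Data.List using (List; []; _∷_; _++_; length; lookup; tabulate; map; allFin)
open import Data.List.Properties using (map-tabulate)
open import Data.Nat.ListAction using (sum)
open import Data.List.Relation.Unary.All as All using (All; []; _∷_)
open import Data.List.Relation.Unary.All.Properties.Core using (¬Any⇒All¬)
open import Data.List.Relation.Unary.AllPairs as AllPairs using (AllPairs; []; _∷_)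
open import Data.List.Relation.Unary.AllPairs.Properties using (drop⁺) renaming (++⁺ to AllPairs-++⁺)
open import Data.List.Relation.Unary.All.Properties using () renaming (++⁺ to All-++⁺)
open import Data.List.Relation.Unary.Any using (here; there; any?; index)
open import Data.List.Relation.Unary.Any.Properties using (lookup-index)
open import Data.List.Relation.Unary.Unique.Propositional using (Unique)
open import Data.List.Relation.Unary.Unique.Propositional.Properties
  using () renaming (++⁺ to Unique-++⁺)
open import Data.List.Membership.Propositional using () renaming (_∈_ to _∈ₗ_; _∉_ to _∉ₗ_)
open import Data.List.Membership.Propositional.Properties using (∈-lookup; ∈-++⁻)
open import Algebra.Properties.CommutativeMonoid.Sum +-0-commutativeMonoid
  using (sum-syntax; ∑-distrib-+; ∑-comm; sum-cong-≗; sum-remove) renaming (sum to ∑)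
open import Data.Product using (∃; ∃₂; _×_; _,_; proj₁; proj₂)
open import Data.Sum using (_⊎_; inj₁; inj₂; [_,_]′)
open import Function using (_∘_; id)
open import Function.Bundles using (_⇔_; Equivalence; mk↔ₛ′)
open import Relation.Unary using (Pred)
open import Relation.Binary using (Rel; Symmetric)
open import Relation.Binary.Construct.Closure.ReflexiveTransitive using (Star; ε; _◅_)
open import Relation.Nullary using (yes; no; contradiction)
open import Relation.Binary.PropositionalEquality

∣p∪q∣≤∣p∣+∣q∣ : ∀ {n} (p q : Subset n) → ∣ p ∪ q ∣ ≤ ∣ p ∣ + ∣ q ∣
∣p∪q∣≤∣p∣+∣q∣ []            []            = z≤n
∣p∪q∣≤∣p∣+∣q∣ (inside ∷ p)  (inside ∷ q)  =
  s≤s (≤-trans (∣p∪q∣≤∣p∣+∣q∣ p q) (+-monoʳ-≤ ∣ p ∣ (n≤1+n ∣ q ∣)))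
∣p∪q∣≤∣p∣+∣q∣ (inside ∷ p)  (outside ∷ q) = s≤s (∣p∪q∣≤∣p∣+∣q∣ p q)
∣p∪q∣≤∣p∣+∣q∣ (outside ∷ p) (inside ∷ q)  =
  ≤-trans (s≤s (∣p∪q∣≤∣p∣+∣q∣ p q)) (≤-reflexive (sym (+-suc ∣ p ∣ ∣ q ∣)))
∣p∪q∣≤∣p∣+∣q∣ (outside ∷ p) (outside ∷ q) = ∣p∪q∣≤∣p∣+∣q∣ p q

∣p∣≤1+∣p-x∣ : ∀ {n} (p : Subset n) x → ∣ p ∣ ≤ suc ∣ p - x ∣
∣p∣≤1+∣p-x∣ (inside ∷ p)  zero    = s≤s (≤-reflexive (cong ∣_∣ (sym (p─⊥≡p p))))
∣p∣≤1+∣p-x∣ (outside ∷ p) zero    = ≤-trans (≤-reflexive (cong ∣_∣ (sym (p─⊥≡p p)))) (n≤1+n _)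
∣p∣≤1+∣p-x∣ (inside ∷ p)  (suc x) = s≤s (∣p∣≤1+∣p-x∣ p x)
∣p∣≤1+∣p-x∣ (outside ∷ p) (suc x) = ∣p∣≤1+∣p-x∣ p x

x∉p-x : ∀ {n} (p : Subset n) x → x ∉ p - x
x∉p-x (_ ∷ p) (suc x) (Vec.there x∈p-x) = x∉p-x p x x∈p-x

0<∣p∣⇒Nonempty : ∀ {n} (p : Subset n) → 0 < ∣ p ∣ → Nonempty p
0<∣p∣⇒Nonempty {n} p 0<∣p∣ with nonempty? p
... | yes p≢∅ = p≢∅
... | no  p≡∅ = contradiction (trans (cong ∣_∣ (Empty-unique p≡∅)) (∣⊥∣≡0 n)) (>⇒≢ 0<∣p∣)

length<∣p∣⇒∃∉ : ∀ {n} (xs : List (Fin n)) (p : Subset n) → length xs < ∣ p ∣ →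
                ∃ λ x → x ∈ p × x ∉ₗ xs
length<∣p∣⇒∃∉ []       p 0<∣p∣ with 0<∣p∣⇒Nonempty p 0<∣p∣
... | x , x∈p = x , x∈p , λ ()
length<∣p∣⇒∃∉ (y ∷ xs) p 1+len<∣p∣
  with length<∣p∣⇒∃∉ xs (p - y) (≤-pred (≤-trans 1+len<∣p∣ (∣p∣≤1+∣p-x∣ p y)))
... | x , x∈p-y , x∉xs = x , p─q⊆p p ⁅ y ⁆ x∈p-y , λ where
  (here refl)  → x∉p-x p y x∈p-y
  (there x∈xs) → x∉xs x∈xs

extend-pair-to-four : ∀ {n} {x y : Fin n} (p : Subset n) → x ≢ y → 4 ≤ ∣ p ∣ →
                      ∃₂ λ c d → c ∈ p × d ∈ p × Unique (x ∷ y ∷ c ∷ d ∷ [])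
extend-pair-to-four {x = x} {y} p x≢y 4≤∣p∣
  with length<∣p∣⇒∃∉ (x ∷ y ∷ []) p (≤-trans (n≤1+n 3) 4≤∣p∣)
... | c , c∈p , c∉xy with length<∣p∣⇒∃∉ (x ∷ y ∷ c ∷ []) p 4≤∣p∣
... | d , d∈p , d∉xyc = c , d , c∈p , d∈p ,
  (x≢y ∷ c∉xy ∘ here ∘ sym ∷ d∉xyc ∘ here ∘ sym ∷ []) ∷
  (c∉xy ∘ there ∘ here ∘ sym ∷ d∉xyc ∘ there ∘ here ∘ sym ∷ []) ∷
  (d∉xyc ∘ there ∘ there ∘ here ∘ sym ∷ []) ∷ [] ∷ []

Unique⇒length≤∣p∣ : ∀ {n} {xs : List (Fin n)} {p} → Unique xs → All (_∈ p) xs → length xs ≤ ∣ p ∣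
Unique⇒length≤∣p∣ []           []            = z≤n
Unique⇒length≤∣p∣ {xs = x ∷ xs} {p} (x≢xs ∷ xs!) (x∈p ∷ xs⊆p) =
  ≤-trans (s≤s (Unique⇒length≤∣p∣ xs! xs⊆p-x)) (x∈p⇒∣p-x∣<∣p∣ x∈p)
  where
  xs⊆p-x : All (_∈ p - x) xs
  xs⊆p-x = All.zipWith (λ (x≢y , y∈p) → x∈p∧x≢y⇒x∈p-y y∈p (x≢y ∘ sym)) (x≢xs , xs⊆p)

∣p∣≤length⇒∈ : ∀ {n} {xs : List (Fin n)} {p x} → Unique xs → All (_∈ p) xs → ∣ p ∣ ≤ length xs →
               x ∈ p → x ∈ₗ xs
∣p∣≤length⇒∈ {xs = xs} {x = x} xs! xs⊆p ∣p∣≤len x∈p with any? (x ≟_) xs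
... | yes x∈xs = x∈xs
... | no  x∉xs = contradiction
  (≤-trans (Unique⇒length≤∣p∣ (¬Any⇒All¬ xs x∉xs ∷ xs!) (x∈p ∷ xs⊆p)) ∣p∣≤len) (n≮n _)

Unique⇒AllPairs : ∀ {n r} {R : Rel (Fin n) r} {Q : Subset n} {xs : List (Fin n)} →
                  (∀ x y → x ∈ Q → y ∈ Q → x ≢ y → R x y) →
                  All (_∈ Q) xs → Unique xs → AllPairs R xs
Unique⇒AllPairs Q-clique []           []            = []
Unique⇒AllPairs Q-clique (x∈Q ∷ xs⊆Q) (x≢xs ∷ xs!) =
  All.zipWith (λ (y∈Q , x≢y) → Q-clique _ _ x∈Q y∈Q x≢y) (xs⊆Q , x≢xs) ∷
  Unique⇒AllPairs Q-clique xs⊆Q xs!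

AllPairs-lookup : ∀ {a r} {A : Set a} {R : Rel A r} {xs : List A} → Symmetric R → AllPairs R xs →
                  ∀ {i j} → i ≢ j → R (lookup xs i) (lookup xs j)
AllPairs-lookup R-sym (Rx ∷ _)  {zero}  {zero}  i≢j = contradiction refl i≢j
AllPairs-lookup R-sym (Rx ∷ _)  {zero}  {suc j} _   = All.lookup Rx (∈-lookup j)
AllPairs-lookup R-sym (Rx ∷ _)  {suc i} {zero}  _   = R-sym (All.lookup Rx (∈-lookup i))
AllPairs-lookup R-sym (_  ∷ R!) {suc i} {suc j} i≢j = AllPairs-lookup R-sym R! (i≢j ∘ cong suc)

pair-covers : ∀ {a p} {A : Set a} {P : Pred A p} {x y d e : A} → x ∈ₗ d ∷ e ∷ [] → y ∈ₗ d ∷ e ∷ [] →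
              x ≢ y → P x → P y → All P (d ∷ e ∷ [])
pair-covers (here refl)         (here refl)         x≢y _  _  = contradiction refl x≢y
pair-covers (here refl)         (there (here refl)) _   Px Py = Px ∷ Py ∷ []
pair-covers (there (here refl)) (here refl)         _   Px Py = Py ∷ Px ∷ []
pair-covers (there (here refl)) (there (here refl)) x≢y _  _  = contradiction refl x≢y

sum-tabulate : ∀ {n} (f : Fin n → ℕ) → sum (tabulate f) ≡ ∑ f
sum-tabulate {zero}  f = refl
sum-tabulate {suc n} f = cong (f zero +_) (sum-tabulate (f ∘ suc))

sum-map-allFin : ∀ {n} (f : Fin n → ℕ) → sum (map f (allFin n)) ≡ ∑ f
sum-map-allFin f = trans (cong sum (map-tabulate id f)) (sum-tabulate f)

n*k≤∑ : ∀ {n} k (h : Fin n → ℕ) → (∀ i → k ≤ h i) → n * k ≤ ∑ h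
n*k≤∑ {zero}  k h k≤h = z≤n
n*k≤∑ {suc n} k h k≤h = +-mono-≤ (k≤h zero) (n*k≤∑ k (h ∘ suc) (k≤h ∘ suc))

∑≤n*k⇒≤k : ∀ {n} k (h : Fin n → ℕ) → (∀ i → k ≤ h i) → ∑ h ≤ n * k → ∀ i → h i ≤ k
∑≤n*k⇒≤k {suc n} k h k≤h ∑h≤ i = +-cancelʳ-≤ (n * k) (h i) k (begin
  h i + n * k             ≤⟨ +-monoʳ-≤ (h i) (n*k≤∑ k (removeAt h i) (k≤h ∘ punchIn i)) ⟩
  h i + ∑ (removeAt h i)  ≡⟨ sum-remove h ⟨
  ∑ h                     ≤⟨ ∑h≤ ⟩
  k + n * k               ∎)
  where open ≤-Reasoning

indicator : Bool → ℕ
indicator b = if b then 1 else 0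

∣tabulate∣ : ∀ {n} (b : Fin n → Bool) → ∣ Vec.tabulate b ∣ ≡ ∑[ i < n ] indicator (b i)
∣tabulate∣ {zero}  b = refl
∣tabulate∣ {suc n} b with b zero
... | true  = cong suc (∣tabulate∣ (b ∘ suc))
... | false = ∣tabulate∣ (b ∘ suc)

module _ {n} (G : Graph n) where

  nbhd : Fin n → Subset n
  nbhd v = Vec.tabulate (adj G v)

  closedNbhd : Fin n → Subset n
  closedNbhd v = nbhd v ∪ ⁅ v ⁆

  degree : Fin n → ℕ
  degree v = ∣ nbhd v ∣

  Adj-sym : Symmetric (Adj G)
  Adj-sym {x} {y} xy = trans (symm G y x) xy

  Adj⇒≢ : ∀ {x y} → Adj G x y → x ≢ y
  Adj⇒≢ {x} xy refl = contradiction (trans (sym xy) (irrefl G x)) λ ()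

  Adj⇒∈closedNbhd : ∀ {v u} → Adj G v u → u ∈ closedNbhd v
  Adj⇒∈closedNbhd {v} {u} vu =
    x∈p∪q⁺ (inj₁ (lookup⇒[]= u (nbhd v) (trans (lookup∘tabulate (adj G v) u) vu)))

  ∈closedNbhd : ∀ v → v ∈ closedNbhd v
  ∈closedNbhd v = x∈p∪q⁺ (inj₂ (x∈⁅x⁆ v))

  ∣closedNbhd∣≤1+degree : ∀ v → ∣ closedNbhd v ∣ ≤ suc (degree v)
  ∣closedNbhd∣≤1+degree v = ≤-trans (∣p∪q∣≤∣p∣+∣q∣ (nbhd v) ⁅ v ⁆)
    (≤-reflexive (trans (cong (degree v +_) (∣⁅x⁆∣≡1 v)) (+-comm (degree v) 1)))

  adj-split : ∀ i j → indicator (adj G i j) ≡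
    indicator ((toℕ i <ᵇ toℕ j) ∧ adj G i j) + indicator ((toℕ j <ᵇ toℕ i) ∧ adj G j i)
  adj-split i j rewrite symm G j i with toℕ i <ᵇ toℕ j in i<j | toℕ j <ᵇ toℕ i in j<i
  ... | true  | true  = contradiction (<ᵇ⇒< (toℕ j) (toℕ i) (subst T (sym j<i) _))
                                     (<-asym (<ᵇ⇒< (toℕ i) (toℕ j) (subst T (sym i<j) _)))
  ... | true  | false = sym (+-identityʳ _)
  ... | false | true  = refl
  ... | false | false = cong indicator (subst (λ k → adj G i k ≡ false) i≡j (irrefl G i))
    where
    i≡j : i ≡ j
    i≡j = toℕ-injective (≤-antisym (≮⇒≥ (subst T j<i ∘ <⇒<ᵇ)) (≮⇒≥ (subst T i<j ∘ <⇒<ᵇ)))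

  handshake : ∑[ v < n ] degree v ≡ 2 * edgeCount G
  handshake = begin
    ∑[ i < n ] degree i
      ≡⟨ sum-cong-≗ (∣tabulate∣ ∘ adj G) ⟩
    ∑[ i < n ] ∑[ j < n ] indicator (adj G i j)
      ≡⟨ sum-cong-≗ (λ i → trans (sum-cong-≗ (adj-split i))
                                 (∑-distrib-+ (before i) (λ j → before j i))) ⟩
    ∑[ i < n ] (∑[ j < n ] before i j + ∑[ j < n ] before j i)
      ≡⟨ ∑-distrib-+ (λ i → ∑[ j < n ] before i j) (λ i → ∑[ j < n ] before j i) ⟩
    E + ∑[ i < n ] ∑[ j < n ] before j i
      ≡⟨ cong (E +_) (∑-comm (λ i j → before j i)) ⟩
    E + E
      ≡⟨ cong (E +_) (+-identityʳ E) ⟨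
    2 * E
      ≡⟨ cong (2 *_) E≡edgeCount ⟩
    2 * edgeCount G ∎
    where
    open ≡-Reasoning
    before : Fin n → Fin n → ℕ
    before i j = indicator ((toℕ i <ᵇ toℕ j) ∧ adj G i j)
    E : ℕ
    E = ∑[ i < n ] ∑[ j < n ] before i j
    E≡edgeCount : E ≡ edgeCount G
    E≡edgeCount = sym (trans (sum-map-allFin (λ i → sum (map (before i) (allFin n))))
                             (sum-cong-≗ (sum-map-allFin ∘ before)))

  degree≤-of-sparse : ∀ k → (∀ v → k ≤ degree v) → 2 * edgeCount G ≤ n * k → ∀ v → degree v ≤ k
  degree≤-of-sparse k k≤degree 2e≤nk =
    ∑≤n*k⇒≤k k degree k≤degree (subst (_≤ n * k) (sym handshake) 2e≤nk)

  length≤1+degree : ∀ {v} {xs : List (Fin n)} → Unique xs → All (_∈ closedNbhd v) xs →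
                    length xs ≤ suc (degree v)
  length≤1+degree {v} xs! xs⊆N[v] =
    ≤-trans (Unique⇒length≤∣p∣ xs! xs⊆N[v]) (∣closedNbhd∣≤1+degree v)

  closedNbhd-saturated : ∀ {v u} {xs : List (Fin n)} → Unique xs → All (_∈ closedNbhd v) xs →
                         suc (degree v) ≤ length xs → Adj G v u → u ∈ₗ xs
  closedNbhd-saturated {v} xs! xs⊆N[v] 1+deg≤len vu =
    ∣p∣≤length⇒∈ xs! xs⊆N[v] (≤-trans (∣closedNbhd∣≤1+degree v) 1+deg≤len) (Adj⇒∈closedNbhd vu)

  no-isolated-vertex : Connected G → (∃₂ λ x y → Adj G x y) → ∀ v → ∃ (Adj G v)
  no-isolated-vertex (_ , walk) (x , y , xy) v with walk v x
  ... | ε      = y , xy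
  ... | vw ◅ _ = _ , vw

  -- The clique fills the closed neighbourhood of each of its vertices, so walks never leave it.
  complete-of-closed-clique : ∀ {x xs} → Connected G → AllPairs (Adj G) (x ∷ xs) →
                              (∀ v → degree v ≤ length xs) →
                              Isomorphic G (complete (suc (length xs)))
  complete-of-closed-clique {x} {xs} (_ , walk) K! degree≤ =
    mk↔ₛ′ position f (λ i → f-injective (sym (f-position (f i)))) (sym ∘ f-position) ,
    λ u w → trans (cong₂ (adj G) (f-position u) (f-position w)) (adj-f (position u) (position w))
    where
    K : List (Fin n)
    K = x ∷ xs
    f : Fin (length K) → Fin n
    f = lookup K
    f-clique : ∀ {i j} → i ≢ j → Adj G (f i) (f j)
    f-clique = AllPairs-lookup Adj-sym K!
    f-injective : ∀ {i j} → f i ≡ f j → i ≡ j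
    f-injective {i} {j} fi≡fj with i ≟ j
    ... | yes i≡j = i≡j
    ... | no  i≢j = contradiction fi≡fj (Adj⇒≢ (f-clique i≢j))
    -- adj (complete _) i j is defined by cases on i ≟ j, so it reduces in both branches.
    adj-f : ∀ i j → adj G (f i) (f j) ≡ adj (complete (length K)) i j
    adj-f i j with i ≟ j
    ... | yes refl = irrefl G (f i)
    ... | no  i≢j  = f-clique i≢j
    K⊆N[f] : ∀ i → All (_∈ closedNbhd (f i)) K
    K⊆N[f] i = All.tabulate λ z∈K → member (index z∈K) (lookup-index z∈K)
      where
      member : ∀ {z} j → z ≡ f j → z ∈ closedNbhd (f i)
      member j refl with j ≟ i
      ... | yes refl = ∈closedNbhd (f j)
      ... | no  j≢i  = Adj⇒∈closedNbhd (f-clique (j≢i ∘ sym))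
    closed : ∀ {y u} → y ∈ₗ K → Adj G y u → u ∈ₗ K
    closed {u = u} y∈K yu =
      closedNbhd-saturated (AllPairs.map Adj⇒≢ K!) (K⊆N[f] (index y∈K)) (s≤s (degree≤ _))
                           (subst (λ y → Adj G y u) (lookup-index y∈K) yu)
    reachable : ∀ {y u} → y ∈ₗ K → Star (Adj G) y u → u ∈ₗ K
    reachable y∈K ε          = y∈K
    reachable y∈K (yz ◅ z↝u) = reachable (closed y∈K yz) z↝u
    position : Fin n → Fin (length K)
    position u = index (reachable (here refl) (walk x u))
    f-position : ∀ u → u ≡ f (position u)
    f-position u = lookup-index (reachable (here refl) (walk x u))

module _ {n} (G : Graph n) {S : Subset n → Set} (core : SpanningConnectedCore G S) where

  private
    4≤∣Q∣ : ∀ {Q} → S Q → 4 ≤ ∣ Q ∣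
    4≤∣Q∣ {Q} sQ = ≤-reflexive (sym (proj₁ (proj₁ core Q sQ)))
    clique : ∀ {Q} → S Q → ∀ x y → x ∈ Q → y ∈ Q → x ≢ y → Adj G x y
    clique {Q} sQ = proj₂ (proj₁ core Q sQ)
    edge : ∃₂ λ x y → Adj G x y
    edge = proj₁ (proj₂ core)
    cover : ∀ x y → Adj G x y → ∃ λ Q → S Q × EdgeIn Q x y
    cover = proj₁ (proj₂ (proj₂ core))
    meets-only : ∀ Q → S Q → ∀ x y → EdgeIn Q x y → ∃ λ Q′ → S Q′ ×
                 (∀ u v → (EdgeIn Q u v × EdgeIn Q′ u v) ⇔ ((u ≡ x × v ≡ y) ⊎ (u ≡ y × v ≡ x)))
    meets-only = proj₂ (proj₂ (proj₂ (proj₂ core)))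

  second-K4 : ∀ {Q x y} → S Q → x ∈ Q → y ∈ Q → x ≢ y →
              ∃ λ Q′ → S Q′ × x ∈ Q′ × y ∈ Q′ × (∀ {r} → r ∈ Q′ → x ≢ r → y ≢ r → r ∉ Q)
  second-K4 {Q} {x} {y} sQ x∈Q y∈Q x≢y =
    let Q′ , sQ′ , Q∩Q′≡xy = meets-only Q sQ x y (x≢y , x∈Q , y∈Q)
        _ , _ , x∈Q′ , y∈Q′ = Equivalence.from (Q∩Q′≡xy x y) (inj₁ (refl , refl))
    in Q′ , sQ′ , x∈Q′ , y∈Q′ , λ r∈Q′ x≢r y≢r r∈Q →
       [ (λ (_ , r≡y) → y≢r (sym r≡y)) , (λ (x≡y , _) → x≢y x≡y) ]′
         (Equivalence.to (Q∩Q′≡xy x _) ((x≢r , x∈Q , r∈Q) , (x≢r , x∈Q′ , r∈Q′)))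

  K4-through-avoiding : ∀ {Q x y} → S Q → x ∈ Q → y ∈ Q → x ≢ y →
                        ∃₂ λ p q → p ∉ Q × q ∉ Q × AllPairs (Adj G) (x ∷ y ∷ p ∷ q ∷ [])
  K4-through-avoiding {Q} {x} {y} sQ x∈Q y∈Q x≢y with second-K4 sQ x∈Q y∈Q x≢y
  ... | Q′ , sQ′ , x∈Q′ , y∈Q′ , avoids-Q with extend-pair-to-four Q′ x≢y (4≤∣Q∣ sQ′)
  ... | p , q , p∈Q′ , q∈Q′ , xypq!@((_ ∷ x≢p ∷ x≢q ∷ []) ∷ (y≢p ∷ y≢q ∷ []) ∷ _) =
    p , q , avoids-Q p∈Q′ x≢p y≢p , avoids-Q q∈Q′ x≢q y≢q ,
    Unique⇒AllPairs (clique sQ′) (x∈Q′ ∷ y∈Q′ ∷ p∈Q′ ∷ q∈Q′ ∷ []) xypq!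

  -- A copy Q = {v, a, b, c} of K₄ from S, and the two further vertices d, e of a second copy
  -- through the edge va that avoids Q.
  record Flower (v : Fin n) : Set where
    field
      a b c d e : Fin n
      Q         : Subset n
      sQ        : S Q
      vabc⊆Q    : All (_∈ Q) (v ∷ a ∷ b ∷ c ∷ [])
      vabc!     : Unique (v ∷ a ∷ b ∷ c ∷ [])
      de∉Q      : All (_∉ Q) (d ∷ e ∷ [])
      vade      : AllPairs (Adj G) (v ∷ a ∷ d ∷ e ∷ [])

  flower : Connected G → ∀ v → Flower v
  flower conn v =
    let a , va                   = no-isolated-vertex G conn edge v
        Q , sQ , v≢a , v∈Q , a∈Q = cover v a va
        b , c , b∈Q , c∈Q , vabc! = extend-pair-to-four Q v≢a (4≤∣Q∣ sQ)
        d , e , d∉Q , e∉Q , vade  = K4-through-avoiding sQ v∈Q a∈Q v≢a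
    in record
      { a = a ; b = b ; c = c ; d = d ; e = e ; Q = Q ; sQ = sQ
      ; vabc⊆Q = v∈Q ∷ a∈Q ∷ b∈Q ∷ c∈Q ∷ [] ; vabc! = vabc! ; de∉Q = d∉Q ∷ e∉Q ∷ [] ; vade = vade }

  module _ {v} (F : Flower v) where
    open Flower F

    petals : List (Fin n)
    petals = (v ∷ a ∷ b ∷ c ∷ []) ++ (d ∷ e ∷ [])

    vabc : AllPairs (Adj G) (v ∷ a ∷ b ∷ c ∷ [])
    vabc = Unique⇒AllPairs (clique sQ) vabc⊆Q vabc!

    de : AllPairs (Adj G) (d ∷ e ∷ [])
    de = drop⁺ 2 vade

    petals! : Unique petals
    petals! = Unique-++⁺ vabc! (AllPairs.map (Adj⇒≢ G) de)
      λ (u∈vabc , u∈de) → All.lookup de∉Q u∈de (All.lookup vabc⊆Q u∈vabc)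

    petals⊆N[v] : All (_∈ closedNbhd G v) petals
    petals⊆N[v] = ∈closedNbhd G v ∷
      All.map (Adj⇒∈closedNbhd G) (All-++⁺ (AllPairs.head vabc) (All.tail (AllPairs.head vade)))

    5≤degree : 5 ≤ degree G v
    5≤degree = ≤-pred (length≤1+degree G petals! petals⊆N[v])

    module _ (degree≤5 : ∀ u → degree G u ≤ 5) where

      neighbour-outside-Q : ∀ {u} → Adj G v u → u ∉ Q → u ∈ₗ d ∷ e ∷ []
      neighbour-outside-Q vu u∉Q =
        [ (λ u∈vabc → contradiction (All.lookup vabc⊆Q u∈vabc) u∉Q) , id ]′
          (∈-++⁻ (v ∷ a ∷ b ∷ c ∷ [])
                 (closedNbhd-saturated G petals! petals⊆N[v] (s≤s (degree≤5 v)) vu))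

      joined-to-de : ∀ {z} → z ∈ₗ a ∷ b ∷ c ∷ [] → All (Adj G z) (d ∷ e ∷ [])
      joined-to-de {z} z∈abc =
        via (K4-through-avoiding sQ (All.head vabc⊆Q) (All.lookup (All.tail vabc⊆Q) z∈abc)
                                    (All.lookup (AllPairs.head vabc!) z∈abc))
        where
        via : (∃₂ λ p q → p ∉ Q × q ∉ Q × AllPairs (Adj G) (v ∷ z ∷ p ∷ q ∷ [])) →
              All (Adj G z) (d ∷ e ∷ [])
        via (p , q , p∉Q , q∉Q , (_ ∷ vp ∷ vq ∷ []) ∷ (zp ∷ zq ∷ []) ∷ (pq ∷ []) ∷ [] ∷ []) =
          pair-covers (neighbour-outside-Q vp p∉Q) (neighbour-outside-Q vq q∉Q) (Adj⇒≢ G pq) zp zq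

      petals-clique : AllPairs (Adj G) petals
      petals-clique =
        AllPairs-++⁺ vabc de (All.tail (AllPairs.head vade) ∷ All.tabulate joined-to-de)

mainTheorem15 : ∀ {n} (G : Graph n) → Connected G → K4Core G →
    2 * edgeCount G ≤ 5 * n → Isomorphic G (complete 6)
mainTheorem15 {n} G conn (S , core) 2e≤5n =
  complete-of-closed-clique G conn (petals-clique G core (flowers (proj₁ conn)) degree≤5) degree≤5
  where
  flowers : ∀ v → Flower G core v
  flowers = flower G core conn
  degree≤5 : ∀ v → degree G v ≤ 5
  degree≤5 = degree≤-of-sparse G 5 (5≤degree G core ∘ flowers)
                               (subst (2 * edgeCount G ≤_) (*-comm 5 n) 2e≤5n)
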